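{- Let $\mathfrak{D}'$ be a class of finite digraphs and $R_1,R_2$ finite digraphs such that one of the following holds: (i) $\mathfrak{D}'=\mathfrak{D}$; (ii) $\mathfrak{T}_a\subseteq\mathfrak{D}'\subseteq\mathfrak{D}$ and $R_1,R_2\in\mathfrak{T}_a$; (iii) $\mathfrak{D}'\in\{\mathfrak{P},\mathfrak{P}^*\}$ and $R_1,R_2\in\mathfrak{D}'$. Then for all finite digraphs $S_1,S_2$: if $R_1\sqsubseteq_\Gamma S_1$ and $R_2\sqsubseteq_\Gamma S_2$ with respect to $\mathfrak{D}'$, then $R_1+R_2\sqsubseteq_\Gamma S_1+S_2$ with respect to $\mathfrak{D}'$.
   Context: Digraphs $G=(V(G),A(G))$ have finite non-empty vertex sets and $A(G)\subseteq V(G)\times V(G)$; loops are arcs $vv$, proper arcs $vw$ with $v\ne w$; $G^*$ is $G$ without loops. $G+H$ is the direct sum (disjoint union of vertex sets and arc sets). $\mathcal{H}(G,H)$ is the set of homomorphisms (maps with $\xi(v)\xi(w)\in A(H)$ whenever $vw\in A(G)$). Walks $v_0,\dots,v_I$ ($I\ge1$, consecutive pairs arcs), closed if $v_0=v_I$; acyclic = no closed walk. $\mathfrak{D}$ = all finite digraphs, $\mathfrak{P}$ = finite posets, $\mathfrak{P}^*=\{P^*:P\in\mathfrak{P}\}$, $\mathfrak{T}_a=\{G: G^*\text{ acyclic}\}$. $v,w$ adjacent if $vw$ or $wv$ is an arc; for $X\subseteq V(G)$, $v\in X$, $\gamma_X(v)$ = set of $w\in X$ equal to $v$ or joined to $v$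 by a sequence in $X$ of consecutively adjacent vertices; $\Gamma_\xi(v)=\gamma_{\xi^{ -1}(\xi(v))}(v)$. $R\sqsubseteq_\Gamma S$ with respect to $\mathfrak{D}'$ means: for a representative system $\mathfrak{D}'_r$ of $\mathfrak{D}'$ up to isomorphism there exist injective maps $\rho_G:\mathcal{H}(G,R)\to\mathcal{H}(G,S)$ ($G\in\mathfrak{D}'_r$) with $\Gamma_{\rho_G(\xi)}(v)=\Gamma_\xi(v)$ for all $G\in\mathfrak{D}'_r$, $\xi\in\mathcal{H}(G,R)$, $v\in V(G)$. -}

module Defs where

open import Data.Nat using (ℕ; zero; suc; _+_; _≤_; _<_)
open import Data.Nat.Properties using (≤-trans; m≤m+n)
open import Data.Fin using (Fin; zero; suc; splitAt; inject₁; fromℕ)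
open import Data.Bool using (Bool; true; false; _∧_; not)
open import Data.Sum using (_⊎_; inj₁; inj₂)
open import Data.Product using (Σ; Σ-syntax; _×_; _,_; proj₁)
open import Relation.Nullary using (¬_; does)
open import Relation.Binary.PropositionalEquality using (_≡_)
import Data.Fin.Properties as FinP

record Digraph : Set where
  constructor mkDigraph
  field
    n        : ℕ
    nonempty : 1 ≤ n
    arc      : Fin n → Fin n → Bool
open Digraph public

V : Digraph → Set
V G = Fin (n G)

Arc : (G : Digraph) → V G → V G → Set
Arc G v w = arc G v w ≡ true

star : Digraph → Digraph
star (mkDigraph k ne a) = mkDigraph k ne (λ v w → a v w ∧ not (does (v FinP.≟ w)))

_⊕_ : Digraph → Digraph → Digraph
mkDigraph k ne a ⊕ mkDigraph l ne' b =
  mkDigraph (k + l) (≤-trans ne (m≤m+n k l)) arc'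
  where
  arc' : Fin (k + l) → Fin (k + l) → Bool
  arc' i j with splitAt k i | splitAt k j
  ... | inj₁ x | inj₁ y = a x y
  ... | inj₂ x | inj₂ y = b x y
  ... | inj₁ _ | inj₂ _ = false
  ... | inj₂ _ | inj₁ _ = false

IsHom : (G H : Digraph) → (V G → V H) → Set
IsHom G H ξ = ∀ v w → Arc G v w → Arc H (ξ v) (ξ w)

Hom : Digraph → Digraph → Set
Hom G H = Σ (V G → V H) (IsHom G H)

IsWalk : (G : Digraph) (I : ℕ) → (Fin (suc I) → V G) → Set
IsWalk G I f = ∀ (i : Fin I) → Arc G (f (inject₁ i)) (f (suc i))

ClosedWalk : Digraph → Set
ClosedWalk G = Σ[ I ∈ ℕ ] (1 ≤ I × Σ[ f ∈ (Fin (suc I) → V G) ]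
                 (IsWalk G I f × f zero ≡ f (fromℕ I)))

Acyclic : Digraph → Set
Acyclic G = ¬ ClosedWalk G

InTa : Digraph → Set
InTa G = Acyclic (star G)

IsPoset : Digraph → Set
IsPoset G = (∀ v → Arc G v v)
          × (∀ v w → Arc G v w → Arc G w v → v ≡ w)
          × (∀ u v w → Arc G u v → Arc G v w → Arc G u w)

InPosetStar : Digraph → Set
InPosetStar G = Σ[ a ∈ (V G → V G → Bool) ]
  (IsPoset (mkDigraph (n G) (nonempty G) a)
   × (∀ v w → arc (star (mkDigraph (n G) (nonempty G) a)) v w ≡ arc G v w))

Adj : (G : Digraph) → V G → V G → Set
Adj G v w = Arc G v w ⊎ Arc G w v

-- InΓ G H ξ v w  :  w ∈ Γ_ξ(v) = γ_{ξ⁻¹(ξ(v))}(v)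
data InΓ (G H : Digraph) (ξ : V G → V H) (v : V G) : V G → Set where
  here : InΓ G H ξ v v
  step : ∀ {u w} → InΓ G H ξ v u → Adj G u w → ξ w ≡ ξ v → InΓ G H ξ v w

Class : Set₁
Class = Digraph → Set

_⇔′_ : Set → Set → Set
A ⇔′ B = (A → B) × (B → A)

SqsubΓ : Class → Digraph → Digraph → Set
SqsubΓ D′ R S = ∀ (G : Digraph) → D′ G →
  Σ[ ρ ∈ (Hom G R → Hom G S) ]
    ( (∀ ξ₁ ξ₂ → (∀ v → proj₁ (ρ ξ₁) v ≡ proj₁ (ρ ξ₂) v) → ∀ v → proj₁ ξ₁ v ≡ proj₁ ξ₂ v)
    × (∀ ξ v w → InΓ G S (proj₁ (ρ ξ)) v w ⇔′ InΓ G R (proj₁ ξ) v w))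

{-# OPTIONS --safe #-}
-- A homomorphism ξ : G → R₁ + R₂ has no arcs between the preimages of the two
-- summands, so it splits G into two unions of connected components. When 𝔇′ is
-- closed under induced subgraphs, the embeddings for R₁ and R₂ can be applied to the
-- two induced subgraphs separately and the results glued together; every Γ_ξ(v)
-- lies inside one part and is computed there. 𝔇, 𝔓 and 𝔓* are closed under induced
-- subgraphs, which settles (i) and (iii).
--
-- 𝔗_a is closed under induced subgraphs too, so in case (ii) we get R₁ + R₂ ⊑_Γ S₁ + S₂
-- with respect to 𝔗_a, and R₁ + R₂ ∈ 𝔗_a. For R ∈ 𝔗_a an embedding for 𝔗_a extends
-- to every digraph G: contract each Γ_ξ(v) to one vertex. ξ is still a homomorphism
-- on the contraction H, and H ∈ 𝔗_a since a closed walk in H* would map to one in R*.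
-- Composing the contraction with the image of ξ under the embedding for H gives the
-- required homomorphism; its Γ-classes are those of ξ, so it determines the
-- contraction, and injectivity follows from injectivity for H.

module Submission where

open import Defs
open import Data.Product using (_×_)
open import Data.Sum using (_⊎_)

open import Data.Bool using (Bool; true; false; _∧_; not; if_then_else_)
import Data.Bool.Properties as Boolₚ
open import Data.Empty using (⊥-elim; ⊥-elim-irr)
open import Data.Fin using (Fin; zero; suc; inject₁; fromℕ; fromℕ<; splitAt; _↑ˡ_; _↑ʳ_)
import Data.Fin.Properties as Finₚ
open import Data.Fin.Subset using (Subset; _∈_; ∣_∣; _⊆_; _⊂_; ⁅_⁆)
import Data.Fin.Subset.Properties as Subsetₚ
open import Data.Nat as ℕ using (ℕ; zero; suc; _≤_; z≤n; s≤s; _≤?_)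
import Data.Nat.Properties as ℕₚ
open import Data.Product using (Σ; ∃; _,_; proj₁; proj₂)
import Data.Sum
open import Data.Sum using (inj₁; inj₂; [_,_]; fromInj₁; fromInj₂)
open import Data.Unit using (⊤; tt)
open import Data.Vec using (Vec; _∷_; here; there; lookup)
import Data.Vec as Vec
import Data.Vec.Properties as Vecₚ
open import Function using (_∘_; const)
open import Function.Bundles using (mk⇔)
open import Function.Definitions using (Injective)
open import Relation.Nullary using (¬_; Dec; yes; no; does; recompute; ¬?)
open import Relation.Nullary.Decidable using (does-⇔; dec-true; _⊎-dec_; _×-dec_)
open import Relation.Binary.PropositionalEquality
  using (_≡_; _≢_; refl; sym; trans; cong; cong₂; subst; subst₂; module ≡-Reasoning)
open ≡-Reasoning

dec-true⁻ : ∀ {A : Set} (a? : Dec A) → does a? ≡ true → A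
dec-true⁻ (yes a) _ = a

star-arc⁻ : (G : Digraph) {v w : V G} → Arc (star G) v w → Arc G v w × v ≢ w
star-arc⁻ G {v} {w} p with v Finₚ.≟ w | arc G v w
... | no v≢w | true = refl , v≢w

star-arc⁺ : (G : Digraph) {v w : V G} → Arc G v w → v ≢ w → Arc (star G) v w
star-arc⁺ G {v} {w} a v≢w with v Finₚ.≟ w
... | yes v≡w = ⊥-elim (v≢w v≡w)
... | no _ = trans (Boolₚ.∧-identityʳ (arc G v w)) a

adj-sym : (G : Digraph) {v w : V G} → Adj G v w → Adj G w v
adj-sym G (inj₁ a) = inj₂ a
adj-sym G (inj₂ a) = inj₁ a

module _ {G H : Digraph} {ξ : V G → V H} where

  InΓ-fibre : ∀ {v w} → InΓ G H ξ v w → ξ w ≡ ξ v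
  InΓ-fibre here = refl
  InΓ-fibre (step _ _ e) = e

  InΓ-trans : ∀ {u v w} → InΓ G H ξ u v → InΓ G H ξ v w → InΓ G H ξ u w
  InΓ-trans p here = p
  InΓ-trans p (step q a e) = step (InΓ-trans p q) a (trans e (InΓ-fibre p))

  InΓ-sym : ∀ {v w} → InΓ G H ξ v w → InΓ G H ξ w v
  InΓ-sym here = here
  InΓ-sym (step p a e) =
    InΓ-trans (step here (adj-sym G a) (trans (InΓ-fibre p) (sym e))) (InΓ-sym p)

InΓ-cong : ∀ {G H : Digraph} {ξ ζ : V G → V H} → (∀ x → ξ x ≡ ζ x) →
           ∀ {v w} → InΓ G H ξ v w → InΓ G H ζ v w
InΓ-cong eq here = here
InΓ-cong eq {v} (step {w = w} p a e) =
  step (InΓ-cong eq p) a (trans (sym (eq w)) (trans e (eq v)))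

start : (G : Digraph) → ClosedWalk G → V G
start G (_ , _ , f , _) = f zero

start-target : (G : Digraph) (c : ClosedWalk G) → ∃ λ u → Arc G u (start G c)
start-target G (suc I , _ , f , walk , closed) =
  f (inject₁ (fromℕ I)) , subst (Arc G (f (inject₁ (fromℕ I)))) (sym closed) (walk (fromℕ I))

walk-invariant : (G : Digraph) (Q : V G → Set) → (∀ {v w} → Arc G v w → Q v → Q w) →
                 ∀ {I f} → IsWalk G I f → Q (f zero) → ∀ i → Q (f i)
walk-invariant G Q preserved walk q zero = q
walk-invariant G Q preserved {suc I} {f} walk q (suc i) =
  walk-invariant G Q preserved {I} {f ∘ suc} (walk ∘ suc) (preserved (walk zero) q) i

closedWalk-map : (A B : Digraph) (Q : V A → Set) (h : V A → V B) →
                 (∀ {v w} → Arc A v w → Q v → Q w) →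
                 (∀ {v w} → Arc A v w → Q v → Arc B (h v) (h w)) →
                 (c : ClosedWalk A) → Q (start A c) → ClosedWalk B
closedWalk-map A B Q h preserved map-arc (I , 1≤I , f , walk , closed) q =
  I , 1≤I , h ∘ f , (λ i → map-arc (walk i) (onWalk (inject₁ i))) , cong h closed
  where
  onWalk = walk-invariant A Q preserved {I} {f} walk q

embed : ∀ {N} (σ : Subset N) → Fin ∣ σ ∣ → Fin N
embed (true ∷ σ) zero = zero
embed (true ∷ σ) (suc i) = suc (embed σ i)
embed (false ∷ σ) i = suc (embed σ i)

index : ∀ {N} {σ : Subset N} {v} → v ∈ σ → Fin ∣ σ ∣
index {σ = true ∷ σ} here = zero
index {σ = true ∷ σ} (there p) = suc (index p)
index {σ = false ∷ σ} (there p) = index p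

embed-index : ∀ {N} {σ : Subset N} {v} (p : v ∈ σ) → embed σ (index p) ≡ v
embed-index {σ = true ∷ σ} here = refl
embed-index {σ = true ∷ σ} (there p) = cong suc (embed-index p)
embed-index {σ = false ∷ σ} (there p) = cong suc (embed-index p)

embed-∈ : ∀ {N} (σ : Subset N) i → embed σ i ∈ σ
embed-∈ (true ∷ σ) zero = here
embed-∈ (true ∷ σ) (suc i) = there (embed-∈ σ i)
embed-∈ (false ∷ σ) i = there (embed-∈ σ i)

index-embed : ∀ {N} {σ : Subset N} i {v} (p : v ∈ σ) → embed σ i ≡ v → index p ≡ i
index-embed {σ = true ∷ σ} zero here refl = refl
index-embed {σ = true ∷ σ} (suc i) (there p) refl = cong suc (index-embed i p refl)
index-embed {σ = false ∷ σ} i (there p) refl = index-embed i p refl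

embed-injective : ∀ {N} (σ : Subset N) → Injective _≡_ _≡_ (embed σ)
embed-injective σ {i} {j} e =
  trans (sym (index-embed i (embed-∈ σ j) e)) (index-embed j (embed-∈ σ j) refl)

index-irrelevant : ∀ {N} {σ : Subset N} {v} (p q : v ∈ σ) → index p ≡ index q
index-irrelevant p q = sym (index-embed (index p) q (embed-index p))

select : ∀ {N} {P : Fin N → Set} → (∀ x → Dec (P x)) → Subset N
select P? = Vec.tabulate (does ∘ P?)

∈-select⁺ : ∀ {N} {P : Fin N → Set} (P? : ∀ x → Dec (P x)) {x} → P x → x ∈ select P?
∈-select⁺ P? {x} px =
  Vecₚ.lookup⇒[]= x (select P?) (trans (Vecₚ.lookup∘tabulate _ x) (dec-true (P? x) px))

∈-select⁻ : ∀ {N} {P : Fin N → Set} (P? : ∀ x → Dec (P x)) {x} → x ∈ select P? → P x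
∈-select⁻ P? {x} x∈ =
  dec-true⁻ (P? x) (trans (sym (Vecₚ.lookup∘tabulate _ x)) (Vecₚ.[]=⇒lookup x∈))

⊆∧⊄⇒≡ : ∀ {N} {S T : Subset N} → S ⊆ T → ¬ S ⊂ T → T ≡ S
⊆∧⊄⇒≡ {S = S} {T} S⊆T S⊄T = Subsetₚ.⊆-antisym T⊆S S⊆T
  where
  T⊆S : T ⊆ S
  T⊆S {x} x∈T with x Subsetₚ.∈? S
  ... | yes x∈S = x∈S
  ... | no x∉S = ⊥-elim (S⊄T (S⊆T , x , x∈T , x∉S))

module Saturation {N : ℕ} (grow : Subset N → Subset N) (inflationary : ∀ S → S ⊆ grow S) where

  grown : ℕ → Subset N → Subset N
  grown zero S = S
  grown (suc k) S = grow (grown k S)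

  saturate : Subset N → Subset N
  saturate = grown (suc N)

  private
    -- A step that is not stable adds a vertex, so N + 1 steps reach a fixed point.
    stable-or-large : ∀ k S → grow (grown k S) ≡ grown k S ⊎ k ≤ ∣ grown k S ∣
    stable-or-large zero S = inj₂ z≤n
    stable-or-large (suc k) S with stable-or-large k S
    ... | inj₁ stable = inj₁ (cong grow stable)
    ... | inj₂ large with grown k S Subsetₚ.⊂? grow (grown k S)
    ...   | yes strict = inj₂ (ℕₚ.≤-trans (s≤s large) (Subsetₚ.p⊂q⇒∣p∣<∣q∣ strict))
    ...   | no ¬strict = inj₁ (cong grow (⊆∧⊄⇒≡ (inflationary (grown k S)) ¬strict))

  saturate-stable : ∀ S → grow (saturate S) ≡ saturate S
  saturate-stable S with stable-or-large (suc N) S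
  ... | inj₁ stable = stable
  ... | inj₂ large = ⊥-elim (ℕₚ.<⇒≱ large (Subsetₚ.∣p∣≤n (saturate S)))

  ⊆-saturate : ∀ S → S ⊆ saturate S
  ⊆-saturate S = go (suc N)
    where
    go : ∀ k → S ⊆ grown k S
    go zero x∈ = x∈
    go (suc k) x∈ = inflationary (grown k S) (go k x∈)

  saturate-induction : (Q : Fin N → Set) →
                       (∀ T → (∀ {x} → x ∈ T → Q x) → ∀ {x} → x ∈ grow T → Q x) →
                       ∀ S → (∀ {x} → x ∈ S → Q x) → ∀ {x} → x ∈ saturate S → Q x
  saturate-induction Q preserved S base = go (suc N)
    where
    go : ∀ k {x} → x ∈ grown k S → Q x
    go zero = base
    go (suc k) = preserved (grown k S) (go k)

pick : ∀ {N} → Subset N → Fin N → Fin N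
pick σ d with Finₚ.any? (Subsetₚ._∈? σ)
... | yes (x , _) = x
... | no _ = d

pick-∈ : ∀ {N} (σ : Subset N) {d} → d ∈ σ → pick σ d ∈ σ
pick-∈ σ d∈ with Finₚ.any? (Subsetₚ._∈? σ)
... | yes (_ , x∈) = x∈
... | no _ = d∈

pick-default : ∀ {N} (σ : Subset N) {d e} → d ∈ σ → pick σ d ≡ pick σ e
pick-default σ {d} d∈ with Finₚ.any? (Subsetₚ._∈? σ)
... | yes _ = refl
... | no ∄ = ⊥-elim (∄ (d , d∈))

-- Induced subgraphs

-- The proof of 1 ≤ ∣ σ ∣ is irrelevant, so Induced G σ ne is one and the same
-- digraph whichever witness ne is supplied.
Induced : (G : Digraph) (σ : Subset (n G)) → .(1 ≤ ∣ σ ∣) → Digraph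
Induced G σ ne =
  mkDigraph ∣ σ ∣ (recompute (1 ≤? ∣ σ ∣) ne) (λ i j → arc G (embed σ i) (embed σ j))

ClosedUnderInduced : Class → Set
ClosedUnderInduced D = ∀ G σ .(ne : 1 ≤ ∣ σ ∣) → D G → D (Induced G σ ne)

isPoset-pullback : ∀ {k m} (ne : 1 ≤ k) (ne′ : 1 ≤ m) (a : Fin k → Fin k → Bool)
                   (e : Fin m → Fin k) → Injective _≡_ _≡_ e → IsPoset (mkDigraph k ne a) →
                   IsPoset (mkDigraph m ne′ (λ i j → a (e i) (e j)))
isPoset-pullback ne ne′ a e e-inj (refl′ , antisym , trans′) =
  (λ v → refl′ (e v)) ,
  (λ v w p q → e-inj (antisym (e v) (e w) p q)) ,
  (λ u v w p q → trans′ (e u) (e v) (e w) p q)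

isPoset-induced : ClosedUnderInduced IsPoset
isPoset-induced G σ ne =
  isPoset-pullback (nonempty G) (nonempty (Induced G σ ne)) (arc G) (embed σ) (embed-injective σ)

inPosetStar-induced : ClosedUnderInduced InPosetStar
inPosetStar-induced G σ ne (a , poset , a*≡arc) =
  (λ i j → a (embed σ i) (embed σ j)) ,
  isPoset-pullback (nonempty G) (nonempty (Induced G σ ne)) a (embed σ) (embed-injective σ) poset ,
  λ i j → trans (cong (λ b → a (embed σ i) (embed σ j) ∧ not b) (same-loops i j))
                (a*≡arc (embed σ i) (embed σ j))
  where
  same-loops : ∀ i j → does (i Finₚ.≟ j) ≡ does (embed σ i Finₚ.≟ embed σ j)
  same-loops i j =
    does-⇔ (mk⇔ (cong (embed σ)) (embed-injective σ)) (i Finₚ.≟ j) (embed σ i Finₚ.≟ embed σ j)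

inTa-induced : ClosedUnderInduced InTa
inTa-induced G σ ne acyclic c =
  acyclic (closedWalk-map (star (Induced G σ ne)) (star G) (λ _ → ⊤) (embed σ) (λ _ _ → tt)
                          star-embed c tt)
  where
  star-embed : ∀ {i j} → Arc (star (Induced G σ ne)) i j → ⊤ →
               Arc (star G) (embed σ i) (embed σ j)
  star-embed a _ with star-arc⁻ (Induced G σ ne) a
  ... | a′ , i≢j = star-arc⁺ G a′ (i≢j ∘ embed-injective σ)

module InducedΓ (G : Digraph) (σ : Subset (n G)) .(ne : 1 ≤ ∣ σ ∣)
                (σ-closed : ∀ {u w} → Adj G u w → u ∈ σ → w ∈ σ) where

  module _ {X Y : Digraph} {F : V G → V X} {ξ : V (Induced G σ ne) → V Y}
           {j : V Y → V X} (j-inj : Injective _≡_ _≡_ j)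
           (F∘embed : ∀ i → F (embed σ i) ≡ j (ξ i)) where

    InΓ-restrict : ∀ i {w} → InΓ G X F (embed σ i) w →
                   ∃ λ i′ → embed σ i′ ≡ w × InΓ (Induced G σ ne) Y ξ i i′
    InΓ-restrict i here = i , refl , here
    InΓ-restrict i (step {w = w} p a e) with InΓ-restrict i p
    ... | i″ , refl , p′ = index w∈σ , embed-index w∈σ , step p′ a′ e′
      where
      w∈σ = σ-closed a (embed-∈ σ i″)
      a′ : Adj (Induced G σ ne) i″ (index w∈σ)
      a′ = subst (Adj G (embed σ i″)) (sym (embed-index w∈σ)) a
      e′ : ξ (index w∈σ) ≡ ξ i
      e′ = j-inj (trans (sym (F∘embed (index w∈σ)))
                  (trans (cong F (embed-index w∈σ)) (trans e (F∘embed i))))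

    InΓ-extend : ∀ {i i′} → InΓ (Induced G σ ne) Y ξ i i′ →
                 InΓ G X F (embed σ i) (embed σ i′)
    InΓ-extend here = here
    InΓ-extend {i} (step {w = w} p a e) =
      step (InΓ-extend p) a (trans (F∘embed w) (trans (cong j e) (sym (F∘embed i))))

  InΓ-transfer : ∀ {X X′ Y Y′ : Digraph} {F : V G → V X} {F′ : V G → V X′}
                   {ξ : V (Induced G σ ne) → V Y} {ξ′ : V (Induced G σ ne) → V Y′}
                   {j : V Y → V X} {j′ : V Y′ → V X′} →
                   Injective _≡_ _≡_ j → (∀ i → F (embed σ i) ≡ j (ξ i)) →
                   Injective _≡_ _≡_ j′ → (∀ i → F′ (embed σ i) ≡ j′ (ξ′ i)) →
                   (∀ i i′ → InΓ (Induced G σ ne) Y ξ i i′ → InΓ (Induced G σ ne) Y′ ξ′ i i′) →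
                   ∀ i {w} → InΓ G X F (embed σ i) w → InΓ G X′ F′ (embed σ i) w
  InΓ-transfer j-inj F∘embed j′-inj F′∘embed Γ⇒ i p with InΓ-restrict j-inj F∘embed i p
  ... | i′ , refl , q = InΓ-extend j′-inj F′∘embed (Γ⇒ i i′ q)

-- Direct sums

module Sum (T₁ T₂ : Digraph) where

  T : Bool → Digraph
  T b = if b then T₁ else T₂

  private
    k = n T₁
    l = n T₂

  ι : (b : Bool) → V (T b) → V (T₁ ⊕ T₂)
  ι true a = a ↑ˡ l
  ι false a = k ↑ʳ a

  side : V (T₁ ⊕ T₂) → Bool
  side z = [ const true , const false ] (splitAt k z)

  -- Junk value: on the other summand, proj b returns the first vertex of T b.
  proj : (b : Bool) → V (T₁ ⊕ T₂) → V (T b)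
  proj true z = fromInj₁ (λ _ → fromℕ< (nonempty T₁)) (splitAt k z)
  proj false z = fromInj₂ (λ _ → fromℕ< (nonempty T₂)) (splitAt k z)

  side-ι : ∀ b a → side (ι b a) ≡ b
  side-ι true a rewrite Finₚ.splitAt-↑ˡ k a l = refl
  side-ι false a rewrite Finₚ.splitAt-↑ʳ k l a = refl

  proj-ι : ∀ b a → proj b (ι b a) ≡ a
  proj-ι true a rewrite Finₚ.splitAt-↑ˡ k a l = refl
  proj-ι false a rewrite Finₚ.splitAt-↑ʳ k l a = refl

  ι-injective : ∀ b → Injective _≡_ _≡_ (ι b)
  ι-injective b {a} {a′} e = trans (sym (proj-ι b a)) (trans (cong (proj b) e) (proj-ι b a′))

  ι-proj : ∀ b z → side z ≡ b → ι b (proj b z) ≡ z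
  ι-proj true z e with splitAt (n T₁) z in eq
  ... | inj₁ a = Finₚ.splitAt⁻¹-↑ˡ eq
  ι-proj false z e with splitAt (n T₁) z in eq
  ... | inj₂ a = Finₚ.splitAt⁻¹-↑ʳ eq

  arc-ι : ∀ b a a′ → arc (T₁ ⊕ T₂) (ι b a) (ι b a′) ≡ arc (T b) a a′
  arc-ι true a a′ rewrite Finₚ.splitAt-↑ˡ k a l | Finₚ.splitAt-↑ˡ k a′ l = refl
  arc-ι false a a′ rewrite Finₚ.splitAt-↑ʳ k l a | Finₚ.splitAt-↑ʳ k l a′ = refl

  arc-side : ∀ {x y} → Arc (T₁ ⊕ T₂) x y → side x ≡ side y
  arc-side {x} {y} a with splitAt k x | splitAt k y
  ... | inj₁ _ | inj₁ _ = refl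
  ... | inj₂ _ | inj₂ _ = refl

  adj-side : ∀ {x y} → Adj (T₁ ⊕ T₂) x y → side x ≡ side y
  adj-side (inj₁ a) = arc-side a
  adj-side (inj₂ a) = sym (arc-side a)

  inTa-⊕ : (∀ b → InTa (T b)) → InTa (T₁ ⊕ T₂)
  inTa-⊕ acyclic c =
    acyclic b (closedWalk-map (star (T₁ ⊕ T₂)) (star (T b)) (λ z → side z ≡ b) (proj b)
                              stays project c refl)
    where
    b = side (start (star (T₁ ⊕ T₂)) c)
    stays : ∀ {x y} → Arc (star (T₁ ⊕ T₂)) x y → side x ≡ b → side y ≡ b
    stays a e = trans (sym (arc-side (proj₁ (star-arc⁻ (T₁ ⊕ T₂) a)))) e
    project : ∀ {x y} → Arc (star (T₁ ⊕ T₂)) x y → side x ≡ b →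
              Arc (star (T b)) (proj b x) (proj b y)
    project {x} {y} a e with star-arc⁻ (T₁ ⊕ T₂) a
    ... | a′ , x≢y = star-arc⁺ (T b)
          (trans (sym (arc-ι b _ _)) (trans (cong₂ (arc (T₁ ⊕ T₂)) x≡ y≡) a′))
          (λ p → x≢y (trans (sym x≡) (trans (cong (ι b) p) y≡)))
      where
      x≡ = ι-proj b x e
      y≡ = ι-proj b y (stays a e)

-- Gluing embeddings along a direct sum

module SqsubΓ-at {D : Class} {R S : Digraph} (sq : SqsubΓ D R S) (G : Digraph) (G∈D : D G) where

  map : Hom G R → Hom G S
  map = proj₁ (sq G G∈D)

  injective : ∀ ξ₁ ξ₂ → (∀ v → proj₁ (map ξ₁) v ≡ proj₁ (map ξ₂) v) →
              ∀ v → proj₁ ξ₁ v ≡ proj₁ ξ₂ v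
  injective = proj₁ (proj₂ (sq G G∈D))

  InΓ-map : ∀ ξ v w → InΓ G S (proj₁ (map ξ)) v w ⇔′ InΓ G R (proj₁ ξ) v w
  InΓ-map = proj₂ (proj₂ (sq G G∈D))

positive : ∀ {m} → Fin m → 1 ≤ m
positive i = ℕ.>-nonZero⁻¹ _ {{Finₚ.nonZeroIndex i}}

part : ∀ {N} → Vec Bool N → Bool → Subset N
part L b = select (λ v → lookup L v Boolₚ.≟ b)

∈-part⁺ : ∀ {N} (L : Vec Bool N) v → v ∈ part L (lookup L v)
∈-part⁺ L v = ∈-select⁺ (λ u → lookup L u Boolₚ.≟ lookup L v) refl

∈-part⁻ : ∀ {N} (L : Vec Bool N) b {v} → v ∈ part L b → lookup L v ≡ b
∈-part⁻ L b = ∈-select⁻ (λ u → lookup L u Boolₚ.≟ b)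

module Gluing (D : Class) (closed : ClosedUnderInduced D) (R₁ R₂ S₁ S₂ : Digraph)
              (sq₁ : SqsubΓ D R₁ S₁) (sq₂ : SqsubΓ D R₂ S₂) where

  module R = Sum R₁ R₂
  module S = Sum S₁ S₂

  sq : ∀ b → SqsubΓ D (R.T b) (S.T b)
  sq true = sq₁
  sq false = sq₂

  -- It is a vector rather than a
  -- function so that homomorphisms with the same sides give propositionally equal
  -- parts, which is what glue-injective needs.
  module Glued (G : Digraph) (G∈D : D G) (L : Vec Bool (n G))
               (f : V G → V (R₁ ⊕ R₂)) (f-hom : IsHom G (R₁ ⊕ R₂) f)
               (f-side : ∀ v → R.side (f v) ≡ lookup L v) where

    part-closed : ∀ b {u w} → Adj G u w → u ∈ part L b → w ∈ part L b
    part-closed b {u} {w} a u∈ = subst (λ c → w ∈ part L c) w≡u (∈-part⁺ L w)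
      where
      f-adj : Adj (R₁ ⊕ R₂) (f u) (f w)
      f-adj = Data.Sum.map (f-hom u w) (f-hom w u) a
      w≡u : lookup L w ≡ b
      w≡u = trans (sym (f-side w))
                  (trans (sym (R.adj-side f-adj)) (trans (f-side u) (∈-part⁻ L b u∈)))

    f-side-part : ∀ b i → R.side (f (embed (part L b) i)) ≡ b
    f-side-part b i = trans (f-side _) (∈-part⁻ L b (embed-∈ (part L b) i))

    ξ : ∀ b → Fin ∣ part L b ∣ → V (R.T b)
    ξ b i = R.proj b (f (embed (part L b) i))

    f∘embed : ∀ b i → f (embed (part L b) i) ≡ R.ι b (ξ b i)
    f∘embed b i = sym (R.ι-proj b _ (f-side-part b i))

    ξ-hom : ∀ b .ne → IsHom (Induced G (part L b) ne) (R.T b) (ξ b)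
    ξ-hom b ne i i′ a =
      trans (sym (R.arc-ι b (ξ b i) (ξ b i′)))
            (trans (cong₂ (arc (R₁ ⊕ R₂)) (sym (f∘embed b i)) (sym (f∘embed b i′))) (f-hom _ _ a))

    module ρ b .ne = SqsubΓ-at (sq b) (Induced G (part L b) ne) (closed G (part L b) ne G∈D)

    η : ∀ b .ne → Fin ∣ part L b ∣ → V (S.T b)
    η b ne = proj₁ (ρ.map b ne (ξ b , ξ-hom b ne))

    glue : ∀ b {v} → v ∈ part L b → V (S₁ ⊕ S₂)
    glue b p = S.ι b (η b (positive (index p)) (index p))

    out : V G → V (S₁ ⊕ S₂)
    out v = glue (lookup L v) (∈-part⁺ L v)

    out-at : ∀ {b v} (p : v ∈ part L b) → out v ≡ glue b p
    out-at {b} {v} p with ∈-part⁻ L b p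
    ... | refl = cong (λ i → S.ι _ (η _ (positive i) i)) (index-irrelevant (∈-part⁺ L v) p)

    out∘embed : ∀ b i → out (embed (part L b) i) ≡ S.ι b (η b (positive i) i)
    out∘embed b i =
      trans (out-at i∈) (cong (λ i′ → S.ι b (η b (positive i) i′)) (index-embed i i∈ refl))
      where i∈ = embed-∈ (part L b) i

    out-hom : IsHom G (S₁ ⊕ S₂) out
    out-hom v w a =
      subst₂ (Arc (S₁ ⊕ S₂)) (sym (out-at p)) (sym (out-at q))
        (trans (S.arc-ι b _ _)
               (proj₂ (ρ.map b ne (ξ b , ξ-hom b ne)) (index p) (index q)
                      (subst₂ (Arc G) (sym (embed-index p)) (sym (embed-index q)) a)))
      where
      b = lookup L v
      p = ∈-part⁺ L v
      q = part-closed b (inj₁ a) p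
      ne = positive (index p)

    side-out : ∀ v → S.side (out v) ≡ R.side (f v)
    side-out v = trans (S.side-ι _ _) (sym (f-side v))

    out-InΓ : ∀ v w → InΓ G (S₁ ⊕ S₂) out v w ⇔′ InΓ G (R₁ ⊕ R₂) f v w
    out-InΓ v w =
      subst (λ u → InΓ G (S₁ ⊕ S₂) out u w ⇔′ InΓ G (R₁ ⊕ R₂) f u w) (embed-index p)
      ( Γ.InΓ-transfer (S.ι-injective b) (out∘embed b) (R.ι-injective b) (f∘embed b)
                       (λ i i′ → proj₁ (ρ.InΓ-map b ne (ξ b , ξ-hom b ne) i i′)) (index p)
      , Γ.InΓ-transfer (R.ι-injective b) (f∘embed b) (S.ι-injective b) (out∘embed b)
                       (λ i i′ → proj₂ (ρ.InΓ-map b ne (ξ b , ξ-hom b ne) i i′)) (index p) )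
      where
      b = lookup L v
      p = ∈-part⁺ L v
      ne = positive (index p)
      module Γ = InducedΓ G (part L b) ne (part-closed b)

  module _ (G : Digraph) (G∈D : D G) where

    glue-injective : ∀ {L₁ L₂} → L₁ ≡ L₂ → ∀ f₁ h₁ s₁ f₂ h₂ s₂ →
                     (∀ v → Glued.out G G∈D L₁ f₁ h₁ s₁ v ≡
                            Glued.out G G∈D L₂ f₂ h₂ s₂ v) →
                     ∀ v → f₁ v ≡ f₂ v
    glue-injective {L} refl f₁ h₁ s₁ f₂ h₂ s₂ out≡ v = begin
      f₁ v                ≡⟨ cong f₁ (sym (embed-index p)) ⟩
      f₁ (embed σ i)      ≡⟨ G₁.f∘embed b i ⟩
      R.ι b (G₁.ξ b i)    ≡⟨ cong (R.ι b) (ξ≡ i) ⟩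
      R.ι b (G₂.ξ b i)    ≡⟨ sym (G₂.f∘embed b i) ⟩
      f₂ (embed σ i)      ≡⟨ cong f₂ (embed-index p) ⟩
      f₂ v                ∎
      where
      module G₁ = Glued G G∈D L f₁ h₁ s₁
      module G₂ = Glued G G∈D L f₂ h₂ s₂
      b = lookup L v
      σ = part L b
      p = ∈-part⁺ L v
      i = index p
      ξ≡ : ∀ i′ → G₁.ξ b i′ ≡ G₂.ξ b i′
      ξ≡ = G₁.ρ.injective b ne (G₁.ξ b , G₁.ξ-hom b ne) (G₂.ξ b , G₂.ξ-hom b ne)
             (λ i′ → S.ι-injective b (trans (sym (G₁.out∘embed b i′))
                                            (trans (out≡ (embed σ i′)) (G₂.out∘embed b i′))))
        where ne = positive i

    sides : (V G → V (R₁ ⊕ R₂)) → Vec Bool (n G)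
    sides f = Vec.tabulate (R.side ∘ f)

    sides-lookup : ∀ f v → R.side (f v) ≡ lookup (sides f) v
    sides-lookup f v = sym (Vecₚ.lookup∘tabulate (R.side ∘ f) v)

    ρ : Hom G (R₁ ⊕ R₂) → Hom G (S₁ ⊕ S₂)
    ρ (f , f-hom) = Glued.out G G∈D (sides f) f f-hom (sides-lookup f) ,
                    Glued.out-hom G G∈D (sides f) f f-hom (sides-lookup f)

    ρ-injective : ∀ ξ₁ ξ₂ → (∀ v → proj₁ (ρ ξ₁) v ≡ proj₁ (ρ ξ₂) v) →
                  ∀ v → proj₁ ξ₁ v ≡ proj₁ ξ₂ v
    ρ-injective (f₁ , h₁) (f₂ , h₂) out≡ =
      glue-injective (Vecₚ.tabulate-cong side≡)
                     f₁ h₁ (sides-lookup f₁) f₂ h₂ (sides-lookup f₂) out≡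
      where
      module G₁ = Glued G G∈D (sides f₁) f₁ h₁ (sides-lookup f₁)
      module G₂ = Glued G G∈D (sides f₂) f₂ h₂ (sides-lookup f₂)
      side≡ : ∀ v → R.side (f₁ v) ≡ R.side (f₂ v)
      side≡ v = trans (sym (G₁.side-out v)) (trans (cong S.side (out≡ v)) (G₂.side-out v))

  sqsubΓ-⊕ : SqsubΓ D (R₁ ⊕ R₂) (S₁ ⊕ S₂)
  sqsubΓ-⊕ G G∈D = ρ G G∈D , ρ-injective G G∈D ,
    λ { (f , f-hom) → Glued.out-InΓ G G∈D (sides G G∈D f) f f-hom (sides-lookup G G∈D f) }

sqsubΓ-⊕ : ∀ {D} → ClosedUnderInduced D → ∀ {R₁ R₂ S₁ S₂} →
           SqsubΓ D R₁ S₁ → SqsubΓ D R₂ S₂ → SqsubΓ D (R₁ ⊕ R₂) (S₁ ⊕ S₂)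
sqsubΓ-⊕ closed sq₁ sq₂ = Gluing.sqsubΓ-⊕ _ closed _ _ _ _ sq₁ sq₂

-- Γ-components and their representatives

adj? : (G : Digraph) (v w : V G) → Dec (Adj G v w)
adj? G v w = (arc G v w Boolₚ.≟ true) ⊎-dec (arc G w v Boolₚ.≟ true)

module Component (G H : Digraph) (ξ : V G → V H) (v : V G) where

  Reached : Subset (n G) → V G → Set
  Reached S w = w ∈ S ⊎ ∃ λ u → u ∈ S × Adj G u w × ξ w ≡ ξ v

  reached? : ∀ S w → Dec (Reached S w)
  reached? S w = w Subsetₚ.∈? S ⊎-dec
                 Finₚ.any? (λ u → u Subsetₚ.∈? S ×-dec (adj? G u w ×-dec (ξ w Finₚ.≟ ξ v)))

  open Saturation (λ S → select (reached? S)) (λ S → ∈-select⁺ (reached? S) ∘ inj₁)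

  component : Subset (n G)
  component = saturate ⁅ v ⁆

  ∈-component⁻ : ∀ {w} → w ∈ component → InΓ G H ξ v w
  ∈-component⁻ = saturate-induction (InΓ G H ξ v) preserved ⁅ v ⁆
                   (λ w∈ → subst (InΓ G H ξ v) (sym (Subsetₚ.x∈⁅y⁆⇒x≡y v w∈)) here)
    where
    preserved : ∀ T → (∀ {x} → x ∈ T → InΓ G H ξ v x) →
                ∀ {x} → x ∈ select (reached? T) → InΓ G H ξ v x
    preserved T reach x∈ with ∈-select⁻ (reached? T) x∈
    ... | inj₁ x∈T = reach x∈T
    ... | inj₂ (u , u∈T , a , e) = step (reach u∈T) a e

  ∈-component⁺ : ∀ {w} → InΓ G H ξ v w → w ∈ component
  ∈-component⁺ here = ⊆-saturate ⁅ v ⁆ (Subsetₚ.x∈⁅x⁆ v)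
  ∈-component⁺ {w} (step p a e) =
    subst (w ∈_) (saturate-stable ⁅ v ⁆)
          (∈-select⁺ (reached? component) (inj₂ (_ , ∈-component⁺ p , a , e)))

module _ {G H : Digraph} where
  open Component G H

  rep : (V G → V H) → V G → V G
  rep ξ v = pick (component ξ v) v

  rep-InΓ : ∀ ξ v → InΓ G H ξ v (rep ξ v)
  rep-InΓ ξ v = ∈-component⁻ ξ v (pick-∈ (component ξ v) (∈-component⁺ ξ v here))

  rep-cong : ∀ ξ ζ v u → (∀ w → InΓ G H ξ v w ⇔′ InΓ G H ζ u w) → rep ξ v ≡ rep ζ u
  rep-cong ξ ζ v u Γ⇔ =
    trans (cong (λ c → pick c v) component≡)
          (pick-default (component ζ u) (∈-component⁺ ζ u (proj₁ (Γ⇔ v) here)))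
    where
    component≡ : component ξ v ≡ component ζ u
    component≡ = Subsetₚ.⊆-antisym (∈-component⁺ ζ u ∘ proj₁ (Γ⇔ _) ∘ ∈-component⁻ ξ v)
                                   (∈-component⁺ ξ v ∘ proj₂ (Γ⇔ _) ∘ ∈-component⁻ ζ u)

  rep-constant : ∀ ξ {v u} → InΓ G H ξ v u → rep ξ v ≡ rep ξ u
  rep-constant ξ p = rep-cong ξ ξ _ _ (λ w → InΓ-trans (InΓ-sym p) , InΓ-trans p)

-- Contracting Γ-components

module _ (G : Digraph) where

  ContractArc : (V G → V G) → V G → V G → Set
  ContractArc π a b = (∃ λ v → ∃ λ w → π v ≡ a × π w ≡ b × Arc G v w) ⊎ (π a ≢ a × π a ≡ b)

  contractArc? : ∀ π a b → Dec (ContractArc π a b)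
  contractArc? π a b =
    Finₚ.any? (λ v → Finₚ.any? (λ w →
      (π v Finₚ.≟ a) ×-dec ((π w Finₚ.≟ b) ×-dec (arc G v w Boolₚ.≟ true))))
    ⊎-dec (¬? (π a Finₚ.≟ a) ×-dec (π a Finₚ.≟ b))

  -- G/π on the vertex set of G: fixed points of π carry the arcs of G between
  -- classes, and every other vertex a has the single arc a → π a, which puts it in
  -- the Γ-class of π a under any homomorphism.
  Contract : (V G → V G) → Digraph
  Contract π = mkDigraph (n G) (nonempty G) (λ a b → does (contractArc? π a b))

module Quotient {G R : Digraph} (ξ : V G → V R) (ξ-hom : IsHom G R ξ) (π : V G → V G)
                (π-InΓ : ∀ v → InΓ G R ξ v (π v))
                (π-constant : ∀ {v u} → InΓ G R ξ v u → π v ≡ π u) where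

  H : Digraph
  H = Contract G π

  arc⁻ : ∀ {a b} → Arc H a b → ContractArc G π a b
  arc⁻ = dec-true⁻ (contractArc? G π _ _)

  arc⁺ : ∀ {a b} → ContractArc G π a b → Arc H a b
  arc⁺ = dec-true (contractArc? G π _ _)

  π-idempotent : ∀ v → π (π v) ≡ π v
  π-idempotent v = sym (π-constant (π-InΓ v))

  ξ∘π : ∀ v → ξ (π v) ≡ ξ v
  ξ∘π v = InΓ-fibre (π-InΓ v)

  π-hom : IsHom G H π
  π-hom v w a = arc⁺ (inj₁ (v , w , refl , refl , a))

  arc-π : ∀ {v w} → Arc G v w → ξ v ≡ ξ w → π v ≡ π w
  arc-π a e = π-constant (step here (inj₁ a) (sym e))

  loop : ∀ {v w} → InΓ G R ξ v w → v ≢ w → Arc R (ξ v) (ξ v)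
  loop here v≢v = ⊥-elim (v≢v refl)
  loop (step {u} {w} p (inj₁ a) e) _ = subst₂ (Arc R) (InΓ-fibre p) e (ξ-hom u w a)
  loop (step {u} {w} p (inj₂ a) e) _ = subst₂ (Arc R) e (InΓ-fibre p) (ξ-hom w u a)

  -- An arc a → π a goes to a loop: a class with two vertices contains an arc.
  ξ-hom-H : IsHom H R ξ
  ξ-hom-H a b arc with arc⁻ arc
  ... | inj₁ (v , w , refl , refl , a′) =
        subst₂ (Arc R) (sym (ξ∘π v)) (sym (ξ∘π w)) (ξ-hom v w a′)
  ... | inj₂ (πa≢a , refl) =
        subst (Arc R (ξ a)) (sym (ξ∘π a)) (loop (π-InΓ a) (πa≢a ∘ sym))

  target-fixed : ∀ {a b} → Arc H a b → π b ≡ b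
  target-fixed arc with arc⁻ arc
  ... | inj₁ (_ , w , _ , refl , _) = π-idempotent w
  ... | inj₂ (_ , refl) = π-idempotent _

  H-inTa : InTa R → InTa H
  H-inTa R-acyclic c =
    R-acyclic (closedWalk-map (star H) (star R) (λ a → π a ≡ a) ξ
                 (λ arc _ → target-fixed (proj₁ (star-arc⁻ H arc))) project c
                 (target-fixed (proj₁ (star-arc⁻ H (proj₂ (start-target (star H) c))))))
    where
    project : ∀ {a b} → Arc (star H) a b → π a ≡ a → Arc (star R) (ξ a) (ξ b)
    project arc fixed with star-arc⁻ H arc
    ... | arc′ , a≢b with arc⁻ arc′
    ...   | inj₁ (v , w , refl , refl , a′) =
            star-arc⁺ R (subst₂ (Arc R) (sym (ξ∘π v)) (sym (ξ∘π w)) (ξ-hom v w a′))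
                        (λ e → a≢b (arc-π a′ (trans (sym (ξ∘π v)) (trans e (ξ∘π w)))))
    ...   | inj₂ (πa≢a , _) = ⊥-elim (πa≢a fixed)

  H-InΓ-π : ∀ {a b} → InΓ H R ξ a b → π a ≡ π b
  H-InΓ-π here = refl
  H-InΓ-π (step {u} {w} p adj e) =
    trans (H-InΓ-π p) (adjacent adj (trans (InΓ-fibre p) (sym e)))
    where
    along : ∀ {x y} → Arc H x y → ξ x ≡ ξ y → π x ≡ π y
    along arc ex with arc⁻ arc
    ... | inj₁ (v , w , refl , refl , a′) =
          cong π (arc-π a′ (trans (sym (ξ∘π v)) (trans ex (ξ∘π w))))
    ... | inj₂ (_ , refl) = sym (π-idempotent _)
    adjacent : Adj H u w → ξ u ≡ ξ w → π u ≡ π w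
    adjacent (inj₁ arc) ex = along arc ex
    adjacent (inj₂ arc) ex = sym (along arc (sym ex))

  H-InΓ-to-π : ∀ a → InΓ H R ξ a (π a)
  H-InΓ-to-π a with π a Finₚ.≟ a
  ... | yes πa≡a = subst (InΓ H R ξ a) (sym πa≡a) here
  ... | no πa≢a = step here (inj₁ (arc⁺ (inj₂ (πa≢a , refl)))) (ξ∘π a)

  π≡⇔InΓ : ∀ v u → (π v ≡ π u) ⇔′ InΓ G R ξ v u
  π≡⇔InΓ v u =
    (λ e → InΓ-trans (π-InΓ v) (subst (λ x → InΓ G R ξ x u) (sym e) (InΓ-sym (π-InΓ u))))
    , π-constant

module Contracting (R S : Digraph) (R-acyclic : InTa R) (sq : SqsubΓ InTa R S) (G : Digraph) where

  Representatives : Vec (V G) (n G) → Set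
  Representatives P =
    Σ (V G → V R) λ ξ → IsHom G R ξ × (∀ v → lookup P v ≡ rep {G} {R} ξ v)

  module RepQuotient (P : Vec (V G) (n G)) (ξ : V G → V R) (ξ-hom : IsHom G R ξ)
                     (P≡rep : ∀ v → lookup P v ≡ rep {G} {R} ξ v) =
    Quotient ξ ξ-hom (lookup P)
      (λ v → subst (InΓ G R ξ v) (sym (P≡rep v)) (rep-InΓ {G} {R} ξ v))
      (λ p → trans (P≡rep _) (trans (rep-constant {G} {R} ξ p) (sym (P≡rep _))))

  -- The witness is irrelevant, so the embedding chosen for the contraction depends
  -- on P alone (see ρ-injective).
  contract-inTa : ∀ P → .(Representatives P) → InTa (Contract G (lookup P))
  contract-inTa P reps c =
    ⊥-elim-irr (RepQuotient.H-inTa P (proj₁ reps) (proj₁ (proj₂ reps)) (proj₂ (proj₂ reps)) R-acyclic c)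

  module ρ P .reps = SqsubΓ-at sq (Contract G (lookup P)) (contract-inTa P reps)

  ρ-injective : ∀ {P₁ P₂} → P₁ ≡ P₂ →
                .(r₁ : Representatives P₁) .(r₂ : Representatives P₂) → ∀ ζ₁ ζ₂ →
                (∀ x → proj₁ (ρ.map P₁ r₁ ζ₁) x ≡ proj₁ (ρ.map P₂ r₂ ζ₂) x) →
                ∀ x → proj₁ ζ₁ x ≡ proj₁ ζ₂ x
  ρ-injective {P} refl r₁ r₂ = ρ.injective P r₁

  module Lifted (ξ : V G → V R) (ξ-hom : IsHom G R ξ) where

    P : Vec (V G) (n G)
    P = Vec.tabulate (rep {G} {R} ξ)

    reps : Representatives P
    reps = ξ , ξ-hom , Vecₚ.lookup∘tabulate (rep {G} {R} ξ)

    open RepQuotient P ξ ξ-hom (Vecₚ.lookup∘tabulate (rep {G} {R} ξ)) public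

    ζ : Hom H R
    ζ = ξ , ξ-hom-H

    η : V G → V S
    η = proj₁ (ρ.map P reps ζ)

    out : V G → V S
    out v = η (lookup P v)

    out-hom : IsHom G S out
    out-hom v w a = proj₂ (ρ.map P reps ζ) _ _ (π-hom v w a)

    η∘π : ∀ x → η (lookup P x) ≡ η x
    η∘π x = InΓ-fibre (proj₂ (ρ.InΓ-map P reps ζ x (lookup P x)) (H-InΓ-to-π x))

    out-InΓ⁺ : ∀ {v w} → InΓ G R ξ v w → InΓ G S out v w
    out-InΓ⁺ here = here
    out-InΓ⁺ (step p a e) =
      step (out-InΓ⁺ p) a (cong η (proj₂ (π≡⇔InΓ _ _) (InΓ-sym (step p a e))))

    out-InΓ⁻ : ∀ {v w} → InΓ G S out v w → lookup P v ≡ lookup P w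
    out-InΓ⁻ here = refl
    out-InΓ⁻ (step {u} {w} p a e) = begin
      lookup P _              ≡⟨ out-InΓ⁻ p ⟩
      lookup P u              ≡⟨ sym (π-idempotent u) ⟩
      lookup P (lookup P u)   ≡⟨ H-InΓ-π Γ ⟩
      lookup P (lookup P w)   ≡⟨ π-idempotent w ⟩
      lookup P w              ∎
      where
      Γ : InΓ H R ξ (lookup P u) (lookup P w)
      Γ = proj₁ (ρ.InΓ-map P reps ζ _ _)
                (step here (Data.Sum.map (π-hom u w) (π-hom w u) a)
                      (trans e (cong η (out-InΓ⁻ p))))

    out-InΓ : ∀ v w → InΓ G S out v w ⇔′ InΓ G R ξ v w
    out-InΓ v w = proj₁ (π≡⇔InΓ v w) ∘ out-InΓ⁻ , out-InΓ⁺

  lift : Hom G R → Hom G S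
  lift (ξ , ξ-hom) = Lifted.out ξ ξ-hom , Lifted.out-hom ξ ξ-hom

  lift-injective : ∀ ξ₁ ξ₂ → (∀ v → proj₁ (lift ξ₁) v ≡ proj₁ (lift ξ₂) v) →
                   ∀ v → proj₁ ξ₁ v ≡ proj₁ ξ₂ v
  lift-injective (ξ₁ , h₁) (ξ₂ , h₂) out≡ =
    ρ-injective (Vecₚ.tabulate-cong (λ v → rep-cong {G} {R} ξ₁ ξ₂ v v (InΓ⇔ v)))
                L₁.reps L₂.reps L₁.ζ L₂.ζ
                (λ x → trans (sym (L₁.η∘π x)) (trans (out≡ x) (L₂.η∘π x)))
    where
    module L₁ = Lifted ξ₁ h₁
    module L₂ = Lifted ξ₂ h₂
    InΓ⇔ : ∀ v w → InΓ G R ξ₁ v w ⇔′ InΓ G R ξ₂ v w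
    InΓ⇔ v w = proj₁ (L₂.out-InΓ v w) ∘ InΓ-cong out≡ ∘ proj₂ (L₁.out-InΓ v w)
             , proj₁ (L₁.out-InΓ v w) ∘ InΓ-cong (sym ∘ out≡) ∘ proj₂ (L₂.out-InΓ v w)

sqsubΓ-of-inTa : ∀ {D R S} → InTa R → SqsubΓ InTa R S → SqsubΓ D R S
sqsubΓ-of-inTa {R = R} {S} R-acyclic sq G _ =
  lift , lift-injective , λ { (ξ , ξ-hom) → Lifted.out-InΓ ξ ξ-hom }
  where open Contracting R S R-acyclic sq G

sqsubΓ-restrict : ∀ {D E R S} → (∀ G → E G → D G) → SqsubΓ D R S → SqsubΓ E R S
sqsubΓ-restrict E⊆D sq G G∈E = sq G (E⊆D G G∈E)

closedUnderInduced-⇔ : ∀ {D E} → (∀ G → D G ⇔′ E G) →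
                       ClosedUnderInduced E → ClosedUnderInduced D
closedUnderInduced-⇔ D⇔E closed G σ ne G∈D =
  proj₂ (D⇔E _) (closed G σ ne (proj₁ (D⇔E G) G∈D))

corollary6 : (D′ : Class) (R₁ R₂ : Digraph) →
    ( (∀ G → D′ G)
    ⊎ (((∀ G → InTa G → D′ G) × InTa R₁ × InTa R₂)
    ⊎ ((((∀ G → D′ G ⇔′ IsPoset G)) ⊎ (∀ G → D′ G ⇔′ InPosetStar G)) × D′ R₁ × D′ R₂))) →
    ∀ (S₁ S₂ : Digraph) → SqsubΓ D′ R₁ S₁ → SqsubΓ D′ R₂ S₂ → SqsubΓ D′ (R₁ ⊕ R₂) (S₁ ⊕ S₂)
corollary6 D′ R₁ R₂ (inj₁ everything) S₁ S₂ =
  sqsubΓ-⊕ (λ G σ ne _ → everything (Induced G σ ne))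
corollary6 D′ R₁ R₂ (inj₂ (inj₁ (Ta⊆D′ , R₁-acyclic , R₂-acyclic))) S₁ S₂ sq₁ sq₂ =
  sqsubΓ-of-inTa (Sum.inTa-⊕ R₁ R₂ λ { true → R₁-acyclic ; false → R₂-acyclic })
    (sqsubΓ-⊕ inTa-induced (sqsubΓ-restrict Ta⊆D′ sq₁) (sqsubΓ-restrict Ta⊆D′ sq₂))
-- In case (iii) closure under induced subgraphs suffices.
corollary6 D′ R₁ R₂ (inj₂ (inj₂ (inj₁ D′⇔poset , _))) S₁ S₂ =
  sqsubΓ-⊕ (closedUnderInduced-⇔ D′⇔poset isPoset-induced)
corollary6 D′ R₁ R₂ (inj₂ (inj₂ (inj₂ D′⇔poset* , _))) S₁ S₂ =
  sqsubΓ-⊕ (closedUnderInduced-⇔ D′⇔poset* inPosetStar-induced)
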